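{- The binary predicate $\mathsf{Sl}$ on $\mathsf{W}^N_3$, where $\mathsf{Sl}(A,B)$ holds iff $B$ is a slice of $A$, is first-order definable (without parameters) in the structure $(\mathsf{W}^N_3,\prec,\Diamond_1,\Diamond_3)$.
   Context: A word is a finite string over $\mathbb{N}$; $\Lambda$ is the empty word, $AB$ is concatenation. $\mathsf{S}_k$ is the set of words all of whose symbols are $\ge k$; $\mathsf{W}_3$ is the set of words with all symbols $\le3$. A relation $\precsim$ on words is defined by induction on (maximal symbol minus minimal symbol) of $AB$: $\Lambda\precsim\Lambda$; if $AB$ is nonempty with minimal symbol $n$, write uniquely $A=A_1n\dots nA_k$, $B=B_1n\dots nB_l$ with $k,l\ge1$ and all $A_i,B_j\in\mathsf{S}_{n+1}$; let $(C_i)$, $(D_j)$ be lexicographically maximal subsequences of $(A_1,\dots,A_k)$, $(B_1,\dots,B_l)$; then $A\precsim B$ iff $(C_i)$ is lexicographically not greater than $(D_j)$. Here $(X_1,\dots,X_p)$ is lexicographically not greater than $(Y_1,\dots,Y_q)$ iff either $p\le q$ and $X_i\sim Y_i$ for all $i\le p$, or there is $s<\min(p,q)$ with $X_i\sim Y_i$ for $i\le s$ and $X_{s+1}\precsim Y_{s+1}$; a lexicographically maximal subsequence is one lexicographically not less than every subsequence. $A\sim B$ iff $A\precsim B$ and $B\precsim A$; $A\prec B$ iff $A\precsim B$ and not $B\precsim A$. $\mathsf{NF}$: $\Lambda\in\mathsf{NF}$; a nonempty word with minimal symbol $n$, written $A_1n\dots nA_k$ with $k\ge2$, $A_i\in\mathsf{S}_{n+1}$,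 is in $\mathsf{NF}$ iff $A_k\precsim\dots\precsim A_1$ and all $A_i\in\mathsf{NF}$. For $A\in\mathsf{NF}$, $\Diamond_nA$ is the unique word of $\mathsf{NF}$ equivalent to $An$. $\mathsf{W}^N_3=\mathsf{W}_3\cap\mathsf{NF}$. For nonempty $A,B\in\mathsf{W}^N_3$, $B$ is a slice of $A$ if there are $n\ge m\ge1$ and words $C_1,\dots,C_n\in\mathsf{S}_1$ with $A=C_10C_20\dots0C_n$ and $B=C_10C_20\dots0C_m$; $\mathsf{Sl}(A,B)$ is false if $A$ or $B$ is empty. -}

module Defs where

open import Data.Nat using (ℕ; zero; suc; _≤_; _⊓_; _⊔_; _≡ᵇ_; _≤ᵇ_)
open import Data.Bool using (Bool; true; false; _∧_; _∨_; not; if_then_else_; T)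
open import Data.List using (List; []; _∷_; _++_; map; foldr; length; take; intercalate; filterᵇ)
open import Data.Bool.ListAction using (all; any)
open import Data.List.Relation.Unary.All using (All)
open import Data.Fin using (Fin)
open import Data.Vec using (Vec; lookup; _∷_)
open import Data.Product using (Σ; _×_; ∃)
open import Data.Sum using (_⊎_)
open import Data.Empty using (⊥)
open import Data.Unit using (⊤)
open import Relation.Nullary using (¬_)
open import Relation.Binary.PropositionalEquality using (_≡_)

Word : Set
Word = List ℕ

maxSym : Word → ℕ
maxSym = foldr _⊔_ 0

-- minimal symbol of a word (only used on nonempty words)
minSym : Word → ℕ
minSym []       = 0
minSym (x ∷ xs) = foldr _⊓_ x xs

pieces : ℕ → Word → List Word
pieces n []       = [] ∷ []
pieces n (x ∷ xs) with pieces n xs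
... | []      = [] ∷ []   -- impossible: pieces is never empty
... | c ∷ cs  = if x ≡ᵇ n then [] ∷ c ∷ cs else (x ∷ c) ∷ cs

subseqs : {X : Set} → List X → List (List X)
subseqs []       = [] ∷ []
subseqs (x ∷ xs) = map (x ∷_) (subseqs xs) ++ subseqs xs

lexLe : {X : Set} → (X → X → Bool) → List X → List X → Bool
lexLe r []       ys       = true
lexLe r (x ∷ xs) []       = false
lexLe r (x ∷ xs) (y ∷ ys) = (r x y ∧ not (r y x)) ∨ ((r x y ∧ r y x) ∧ lexLe r xs ys)

maxSubseqs : {X : Set} → (X → X → Bool) → List X → List (List X)
maxSubseqs r xs = filterᵇ (λ C → all (λ S → lexLe r S C) (subseqs xs)) (subseqs xs)

-- the relation ≾, by recursion on a fuel bounding (max − min) of AB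
leF : ℕ → Word → Word → Bool
leF zero    A B = true
leF (suc f) A B with A ++ B
... | []    = true
... | w ∷ ws =
  let n = minSym (w ∷ ws) in
  any (λ C → any (λ D → lexLe (leF f) C D)
                 (maxSubseqs (leF f) (pieces n B)))
      (maxSubseqs (leF f) (pieces n A))

leB : Word → Word → Bool
leB A B = leF (suc (maxSym (A ++ B))) A B

_≾_ : Word → Word → Set
A ≾ B = T (leB A B)

_≺_ : Word → Word → Set
A ≺ B = A ≾ B × ¬ (B ≾ A)

_∼_ : Word → Word → Set
A ∼ B = A ≾ B × B ≾ A

descending : List Word → Bool
descending []            = true
descending (x ∷ [])      = true
descending (x ∷ y ∷ ys)  = leB y x ∧ descending (y ∷ ys)

nfF : ℕ → Word → Bool
nfF zero    A = true
nfF (suc f) []       = true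
nfF (suc f) (x ∷ xs) =
  let ps = pieces (minSym (x ∷ xs)) (x ∷ xs) in
  descending ps ∧ all (nfF f) ps

isNF : Word → Bool
isNF A = nfF (suc (maxSym A)) A

NF : Word → Set
NF A = T (isNF A)

inW3 : Word → Bool
inW3 = all (λ x → x ≤ᵇ 3)

W3N : Set
W3N = Σ Word (λ A → T (inW3 A ∧ isNF A))

DiamondGraph : ℕ → Word → Word → Set
DiamondGraph n A B = NF B × (B ∼ (A ++ n ∷ []))

Sl : Word → Word → Set
Sl A B =
  ¬ (A ≡ []) × ¬ (B ≡ []) ×
  Σ (List Word) (λ Cs → All (All (1 ≤_)) Cs ×
    Σ ℕ (λ m → 1 ≤ m × m ≤ length Cs ×
      A ≡ intercalate (0 ∷ []) Cs ×
      B ≡ intercalate (0 ∷ []) (take m Cs)))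

-- first-order logic over the signature (≺, ◇₁, ◇₃), with the unary
-- functions ◇₁, ◇₃ represented by their graphs, and with equality.
-- Formulas with n free variables (de Bruijn, Fin n).

data Formula (n : ℕ) : Set where
  _≐_    : Fin n → Fin n → Formula n
  _≺'_   : Fin n → Fin n → Formula n
  ◇₁[_]≐_ : Fin n → Fin n → Formula n
  ◇₃[_]≐_ : Fin n → Fin n → Formula n
  ⊤' ⊥'  : Formula n
  ¬'_    : Formula n → Formula n
  _∧'_ _∨'_ _⇒'_ : Formula n → Formula n → Formula n
  ∀' ∃'  : Formula (suc n) → Formula n

word : W3N → Word
word = Σ.proj₁

Sat : {n : ℕ} → Formula n → Vec W3N n → Set
Sat (x ≐ y)       ρ = word (lookup ρ x) ≡ word (lookup ρ y)
Sat (x ≺' y)      ρ = word (lookup ρ x) ≺ word (lookup ρ y)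
Sat (◇₁[ x ]≐ y)  ρ = DiamondGraph 1 (word (lookup ρ x)) (word (lookup ρ y))
Sat (◇₃[ x ]≐ y)  ρ = DiamondGraph 3 (word (lookup ρ x)) (word (lookup ρ y))
Sat ⊤'            ρ = ⊤
Sat ⊥'            ρ = ⊥
Sat (¬' φ)        ρ = ¬ Sat φ ρ
Sat (φ ∧' ψ)      ρ = Sat φ ρ × Sat ψ ρ
Sat (φ ∨' ψ)      ρ = Sat φ ρ ⊎ Sat ψ ρ
Sat (φ ⇒' ψ)      ρ = Sat φ ρ → Sat ψ ρ
Sat (∀' φ)        ρ = (a : W3N) → Sat φ (a ∷ ρ)
Sat (∃' φ)        ρ = Σ W3N (λ a → Sat φ (a ∷ ρ))

-- Write a word with least letter n as its n-free pieces A₁ n … n Aₖ. The leaders of (A₁, …, Aₖ)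
-- (the pieces not below any later piece) form its lexicographically greatest subsequence, so
-- comparing two words amounts to comparing the leaders of their pieces lexicographically, and a
-- word is in normal form exactly when its pieces are normal and descending, i.e. are their own
-- leaders. Appending the least letter n to a word gives its immediate successor among words with
-- letters ≥ n.
--
-- Let A, B ∈ W₃ᴺ and let b′ bₘ be the pieces of B at 0, so that B1, which is equivalent to ◇₁B,
-- has pieces b′ (bₘ1), where bₘ1 is the immediate successor of bₘ. If B ≼ A ≺ ◇₁B and the pieces of B are not a
-- prefix of those of A, they fall below A's pieces at some position, and then even b′ (bₘ1)
-- together with all its subsequences stays ≤ the pieces of A, contradicting A ≺ ◇₁B.
-- Conversely a slice satisfies B ≼ A ≺ ◇₁B. Since Λ is the least word, B ≠ Λ says that B has a
-- strict predecessor, so Sl(A, B) ⇔ ∃C. C ≺ B ∧ (B = A ∨ B ≺ A) ∧ A ≺ ◇₁B.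

module Submission where

open import Data.Bool using (Bool; true; false; T; _∧_; _∨_; if_then_else_)
open import Data.Bool.ListAction using (all; any)
open import Data.Bool.Properties using (T-∧; ∧-identityʳ)
open import Data.Empty using (⊥-elim)
open import Data.Fin using (Fin; #_)
open import Data.List using (List; []; _∷_; _++_; [_]; map; filterᵇ; length; take; drop; intercalate; foldr; initLast; _∷ʳ′_)
open import Data.List.Membership.Propositional using (_∈_; find; lose)
open import Data.List.Membership.Propositional.Properties using (∈-++⁺ˡ; ∈-++⁺ʳ; ∈-++⁻; ∈-map⁺; ∈-map⁻; ∈-filter⁺; ∈-filter⁻)
open import Data.List.Properties using (++-identityʳ; ++-assoc; ++-conicalʳ; take++drop≡id; length-++)
open import Data.List.Relation.Binary.Lex.Core using (Lex-≤; base; halt; this; next)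
open import Data.List.Relation.Binary.Prefix.Heterogeneous using (Prefix; []; _∷_)
open import Data.List.Relation.Binary.Sublist.Propositional using (_⊆_; []; _∷_; _∷ʳ_; ⊆-refl)
open import Data.List.Relation.Binary.Sublist.Propositional.Properties using (All-resp-⊆; Any-resp-⊆; ∷ˡ⁻)
open import Data.List.Relation.Unary.All as All using (All; []; _∷_)
open import Data.List.Relation.Unary.All.Properties using (all⁺; all⁻; ¬All⇒Any¬; ++⁺; ++⁻ˡ; ++⁻ʳ; take⁺)
open import Data.List.Relation.Unary.Any using (here; there)
open import Data.List.Relation.Unary.Any.Properties using (any⁺; any⁻)
open import Data.List.Relation.Unary.Linked as Linked using (Linked; []; [-]; _∷_)
open import Data.Nat using (ℕ; zero; suc; _≤_; _<_; _+_; _⊓_; _≡ᵇ_; z≤n; s≤s)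
open import Data.Nat.Properties
  using ( _≟_; ≤ᵇ⇒≤; ≤⇒≤ᵇ; ≡ᵇ⇒≡; ≡⇒≡ᵇ; 1+n≢n; n≢0⇒n>0; ≤-refl; ≤-trans; <-irrefl; <-≤-trans; ≤-<-trans; ≤∧≢⇒<
        ; +-identityʳ; +-suc; +-comm; +-monoʳ-≤; m≤n+m; m≤m+n; n≤1+n; m≤m⊔n; m≤n⊔m; m⊓n≤m; m⊓n≤n; ⊓-glb )
open import Data.Product using (Σ; ∃; ∃₂; _×_; _,_; proj₁; proj₂)
open import Data.Product.Function.NonDependent.Propositional using (_×-⇔_)
open import Data.Sum as Sum using (_⊎_; inj₁; inj₂; [_,_]′)
open import Data.Unit using (⊤; tt)
open import Data.Vec using (_∷_; [])
open import Function using (_∘_; flip; case_of_)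
open import Function.Bundles using (_⇔_; mk⇔; Equivalence)
import Function.Properties.Equivalence as ⇔
open import Relation.Binary.PropositionalEquality
  using (_≡_; _≢_; refl; sym; trans; cong; cong₂; subst; subst₂; module ≡-Reasoning)
open import Relation.Nullary using (¬_; yes; no)
open import Relation.Nullary.Decidable using (T?)

open import Defs

open ≡-Reasoning

private variable
  X : Set

T-injective : ∀ {a b : Bool} → (T a ⇔ T b) → a ≡ b
T-injective {true}  {true}  _ = refl
T-injective {false} {false} _ = refl
T-injective {true}  {false} h = ⊥-elim (Equivalence.to h tt)
T-injective {false} {true}  h = ⊥-elim (Equivalence.from h tt)

∷ʳ≢[] : ∀ {X : Set} (l : List X) {x} → l ++ [ x ] ≢ []
∷ʳ≢[] l eq with ++-conicalʳ l _ eq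
... | ()

take-length-++ : ∀ {X : Set} (xs ys : List X) → take (length xs) (xs ++ ys) ≡ xs
take-length-++ []       ys = refl
take-length-++ (x ∷ xs) ys = cong (x ∷_) (take-length-++ xs ys)

all-cong : ∀ {Y : Set} (p p′ : Y → Bool) xs → (∀ {x} → x ∈ xs → p x ≡ p′ x) → all p xs ≡ all p′ xs
all-cong p p′ []       _    = refl
all-cong p p′ (x ∷ xs) p≗p′ = cong₂ _∧_ (p≗p′ (here refl)) (all-cong p p′ xs (p≗p′ ∘ there))

any-cong : ∀ {Y : Set} (p p′ : Y → Bool) xs → (∀ {x} → x ∈ xs → p x ≡ p′ x) → any p xs ≡ any p′ xs
any-cong p p′ []       _    = refl
any-cong p p′ (x ∷ xs) p≗p′ = cong₂ _∨_ (p≗p′ (here refl)) (any-cong p p′ xs (p≗p′ ∘ there))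

filterᵇ-cong : ∀ {Y : Set} (p p′ : Y → Bool) xs → (∀ {x} → x ∈ xs → p x ≡ p′ x) →
               filterᵇ p xs ≡ filterᵇ p′ xs
filterᵇ-cong p p′ []       _    = refl
filterᵇ-cong p p′ (x ∷ xs) p≗p′ with p x | p′ x | p≗p′ (here refl)
... | true  | true  | refl = cong (x ∷_) (filterᵇ-cong p p′ xs (p≗p′ ∘ there))
... | false | false | refl = filterᵇ-cong p p′ xs (p≗p′ ∘ there)

∈-subseqs⁺ : {S xs : List X} → S ⊆ xs → S ∈ subseqs xs
∈-subseqs⁺ []                      = here refl
∈-subseqs⁺ {xs = x ∷ xs} (x ∷ʳ s)  = ∈-++⁺ʳ (map (x ∷_) (subseqs xs)) (∈-subseqs⁺ s)
∈-subseqs⁺ {xs = x ∷ xs} (refl ∷ s) = ∈-++⁺ˡ (∈-map⁺ (x ∷_) (∈-subseqs⁺ s))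

∈-subseqs⁻ : (xs : List X) {S : List X} → S ∈ subseqs xs → S ⊆ xs
∈-subseqs⁻ []       (here refl) = []
∈-subseqs⁻ (x ∷ xs) S∈ with ∈-++⁻ (map (x ∷_) (subseqs xs)) S∈
... | inj₂ S∈′ = x ∷ʳ ∈-subseqs⁻ xs S∈′
... | inj₁ S∈′ with ∈-map⁻ (x ∷_) S∈′
...   | _ , S′∈ , refl = refl ∷ ∈-subseqs⁻ xs S′∈

-- Lexicographic order and maximal subsequences

module LexOrder {X : Set} (r : X → X → Bool) where

  infix 4 _≲_ _≃_ _⋖_ _≤ₗ_ _⋖ₗ_

  _≲_ _≃_ _⋖_ : X → X → Set
  x ≲ y = T (r x y)
  x ≃ y = x ≲ y × y ≲ x
  x ⋖ y = x ≲ y × ¬ y ≲ x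

  _≤ₗ_ : List X → List X → Set
  _≤ₗ_ = Lex-≤ _≃_ _⋖_

  private variable
    x y : X
    u v w : List X

  lexLe⇒≤ₗ : ∀ u v → T (lexLe r u v) → u ≤ₗ v
  lexLe⇒≤ₗ []      []      _ = base tt
  lexLe⇒≤ₗ []      (_ ∷ _) _ = halt
  lexLe⇒≤ₗ (x ∷ u) (y ∷ v) h with r x y in x≲y | r y x in y≲x
  ... | true | false = this (subst T (sym x≲y) tt , subst T y≲x)
  ... | true | true  = next (subst T (sym x≲y) tt , subst T (sym y≲x) tt) (lexLe⇒≤ₗ u v h)

  ≤ₗ⇒lexLe : u ≤ₗ v → T (lexLe r u v)
  ≤ₗ⇒lexLe (base _) = tt
  ≤ₗ⇒lexLe halt     = tt
  ≤ₗ⇒lexLe (this {x} {_} {y} (x≲y , y≴x)) with r x y | r y x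
  ... | true | false = tt
  ... | true | true  = ⊥-elim (y≴x tt)
  ≤ₗ⇒lexLe (next {x} {_} {y} (x≲y , y≲x) u≤v) with r x y | r y x
  ... | true | true = ≤ₗ⇒lexLe u≤v

  []-≤ₗ : ∀ v → [] ≤ₗ v
  []-≤ₗ []      = base tt
  []-≤ₗ (_ ∷ _) = halt

  ∷-≤ₗ⇒≲ : x ∷ u ≤ₗ y ∷ v → x ≲ y
  ∷-≤ₗ⇒≲ (this (x≲y , _))   = x≲y
  ∷-≤ₗ⇒≲ (next (x≲y , _) _) = x≲y

  data _⋖ₗ_ : List X → List X → Set where
    here  : x ⋖ y → x ∷ u ⋖ₗ y ∷ v
    there : x ≃ y → u ⋖ₗ v → x ∷ u ⋖ₗ y ∷ v

  ≤ₗ-split : u ≤ₗ v → Prefix _≃_ u v ⊎ u ⋖ₗ v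
  ≤ₗ-split (base _) = inj₁ []
  ≤ₗ-split halt     = inj₁ []
  ≤ₗ-split (this x⋖y) = inj₂ (here x⋖y)
  ≤ₗ-split (next x≃y u≤v) with ≤ₗ-split u≤v
  ... | inj₁ u⊑v = inj₁ (x≃y ∷ u⊑v)
  ... | inj₂ u⋖v = inj₂ (there x≃y u⋖v)

  ++-≰ₗ : ∀ u → ¬ (u ++ y ∷ v ≤ₗ u)
  ++-≰ₗ []      ()
  ++-≰ₗ (_ ∷ u) (this (x≲x , x≴x)) = x≴x x≲x
  ++-≰ₗ (_ ∷ u) (next _ h)         = ++-≰ₗ u h

  ++⁻-≤ₗ : ∀ w → w ++ u ≤ₗ w ++ v → u ≤ₗ v
  ++⁻-≤ₗ []      h                    = h
  ++⁻-≤ₗ (_ ∷ w) (this (x≲x , x≴x)) = ⊥-elim (x≴x x≲x)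
  ++⁻-≤ₗ (_ ∷ w) (next _ h)         = ++⁻-≤ₗ w h

  maxLexLe : List X → List X → Bool
  maxLexLe xs ys = any (λ C → any (λ D → lexLe r C D) (maxSubseqs r ys)) (maxSubseqs r xs)

  Descending : List X → Set
  Descending = Linked (flip _≲_)

  isLeader : X → List X → Bool
  isLeader x xs = all (λ y → r y x) xs

  leaders : List X → List X
  leaders []       = []
  leaders (x ∷ xs) = if isLeader x xs then x ∷ leaders xs else leaders xs

  leaders-⊆ : ∀ xs → leaders xs ⊆ xs
  leaders-⊆ []       = []
  leaders-⊆ (x ∷ xs) with isLeader x xs
  ... | true  = refl ∷ leaders-⊆ xs
  ... | false = x ∷ʳ leaders-⊆ xs

  Descending-∷ : ∀ {xs} → All (_≲ x) xs → Descending xs → Descending (x ∷ xs)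
  Descending-∷ []          _  = [-]
  Descending-∷ (y≲x ∷ _) ds = y≲x ∷ ds

  leaders-descending : ∀ xs → Descending (leaders xs)
  leaders-descending []       = []
  leaders-descending (x ∷ xs) with isLeader x xs in leader
  ... | true  = Descending-∷ (All-resp-⊆ (leaders-⊆ xs) (all⁺ _ xs (subst T (sym leader) tt)))
                             (leaders-descending xs)
  ... | false = leaders-descending xs

  module Antisymmetric {Q : X → Set} (≃⇒≡ : ∀ {x y} → Q x → Q y → x ≃ y → x ≡ y) where

    Prefix⇒++-drop : All Q u → All Q v → Prefix _≃_ u v → v ≡ u ++ drop (length u) v
    Prefix⇒++-drop _          _          []          = refl
    Prefix⇒++-drop (qx ∷ qu) (qy ∷ qv) (x≃y ∷ u⊑v) =
      cong₂ _∷_ (sym (≃⇒≡ qx qy x≃y)) (Prefix⇒++-drop qu qv u⊑v)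

    ≤ₗ-antisym : All Q u → All Q v → u ≤ₗ v → v ≤ₗ u → u ≡ v
    ≤ₗ-antisym _ _ (base _) _ = refl
    ≤ₗ-antisym _ _ halt ()
    ≤ₗ-antisym _ _ (this (_ , y≴x)) (this (y≲x , _)) = ⊥-elim (y≴x y≲x)
    ≤ₗ-antisym _ _ (this (_ , y≴x)) (next (y≲x , _) _) = ⊥-elim (y≴x y≲x)
    ≤ₗ-antisym _ _ (next (x≲y , _) _) (this (_ , x≴y)) = ⊥-elim (x≴y x≲y)
    ≤ₗ-antisym (qx ∷ qu) (qy ∷ qv) (next x≃y u≤v) (next _ v≤u) =
      cong₂ _∷_ (≃⇒≡ qx qy x≃y) (≤ₗ-antisym qu qv u≤v v≤u)

module _ {X : Set} {P : X → Set} {r r′ : X → X → Bool} (r≗r′ : ∀ {x y} → P x → P y → r x y ≡ r′ x y) where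

  private
    ∈subseqs⇒All : ∀ {xs S} → All P xs → S ∈ subseqs xs → All P S
    ∈subseqs⇒All pxs S∈ = All-resp-⊆ (∈-subseqs⁻ _ S∈) pxs

  lexLe-cong : ∀ {u v} → All P u → All P v → lexLe r u v ≡ lexLe r′ u v
  lexLe-cong []         _          = refl
  lexLe-cong (_ ∷ _)    []         = refl
  lexLe-cong (px ∷ pu) (py ∷ pv) rewrite r≗r′ px py | r≗r′ py px | lexLe-cong pu pv = refl

  maxSubseqs-cong : ∀ {xs} → All P xs → maxSubseqs r xs ≡ maxSubseqs r′ xs
  maxSubseqs-cong {xs} pxs = filterᵇ-cong _ _ (subseqs xs) λ C∈ →
    all-cong _ _ (subseqs xs) λ S∈ → lexLe-cong (∈subseqs⇒All pxs S∈) (∈subseqs⇒All pxs C∈)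

  maxLexLe-cong : ∀ {xs ys} → All P xs → All P ys → LexOrder.maxLexLe r xs ys ≡ LexOrder.maxLexLe r′ xs ys
  maxLexLe-cong {xs} {ys} pxs pys rewrite maxSubseqs-cong pxs | maxSubseqs-cong pys =
    any-cong _ _ (maxSubseqs r′ xs) λ C∈ → any-cong _ _ (maxSubseqs r′ ys) λ D∈ →
      lexLe-cong (∈subseqs⇒All pxs (proj₁ (∈-filter⁻ (T? ∘ _) {xs = subseqs xs} C∈)))
                 (∈subseqs⇒All pys (proj₁ (∈-filter⁻ (T? ∘ _) {xs = subseqs ys} D∈)))

record IsTotalPreorderOn {X : Set} (r : X → X → Bool) (P : X → Set) : Set where
  field
    reflexive  : ∀ {x} → P x → T (r x x)
    transitive : ∀ {x y z} → P x → P y → P z → T (r x y) → T (r y z) → T (r x z)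
    total      : ∀ {x y} → P x → P y → T (r x y) ⊎ T (r y x)

module TotalLexOrder {X : Set} {r : X → X → Bool} {P : X → Set} (tp : IsTotalPreorderOn r P) where

  open LexOrder r public
  open IsTotalPreorderOn tp

  private variable
    x y z : X
    u v w xs ys S : List X

  ≲-trans : P x → P y → P z → x ≲ y → y ≲ z → x ≲ z
  ≲-trans = transitive

  ≃-refl : P x → x ≃ x
  ≃-refl px = reflexive px , reflexive px

  ⋖-≲-trans : P x → P y → P z → x ⋖ y → y ≲ z → x ⋖ z
  ⋖-≲-trans px py pz (x≲y , y≴x) y≲z = ≲-trans px py pz x≲y y≲z , λ z≲x → y≴x (≲-trans py pz px y≲z z≲x)

  ≲-⋖-trans : P x → P y → P z → x ≲ y → y ⋖ z → x ⋖ z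
  ≲-⋖-trans px py pz x≲y (y≲z , z≴y) = ≲-trans px py pz x≲y y≲z , λ z≲x → z≴y (≲-trans pz px py z≲x x≲y)

  ≴⇒⋖ : P x → P y → ¬ y ≲ x → x ⋖ y
  ≴⇒⋖ px py y≴x = [ (λ x≲y → x≲y , y≴x) , (λ y≲x → ⊥-elim (y≴x y≲x)) ]′ (total px py)

  ≲⇒∷-≤ₗ : x ≲ y → u ≤ₗ v → x ∷ u ≤ₗ y ∷ v
  ≲⇒∷-≤ₗ {x} {y} x≲y u≤v with T? (r y x)
  ... | yes y≲x = next (x≲y , y≲x) u≤v
  ... | no  y≴x = this (x≲y , y≴x)

  ≤ₗ-refl : All P u → u ≤ₗ u
  ≤ₗ-refl []         = base tt
  ≤ₗ-refl (px ∷ pxs) = next (≃-refl px) (≤ₗ-refl pxs)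

  ≤ₗ-trans : All P u → All P v → All P w → u ≤ₗ v → v ≤ₗ w → u ≤ₗ w
  ≤ₗ-trans _ _ _ (base _) v≤w = v≤w
  ≤ₗ-trans _ _ (_ ∷ _) halt _ = halt
  ≤ₗ-trans (px ∷ _) (py ∷ _) (pz ∷ _) (this x⋖y) (this y⋖z) = this (⋖-≲-trans px py pz x⋖y (proj₁ y⋖z))
  ≤ₗ-trans (px ∷ _) (py ∷ _) (pz ∷ _) (this x⋖y) (next y≃z _) = this (⋖-≲-trans px py pz x⋖y (proj₁ y≃z))
  ≤ₗ-trans (px ∷ _) (py ∷ _) (pz ∷ _) (next x≃y _) (this y⋖z) = this (≲-⋖-trans px py pz (proj₁ x≃y) y⋖z)
  ≤ₗ-trans (px ∷ pu) (py ∷ pv) (pz ∷ pw) (next x≃y u≤v) (next y≃z v≤w) =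
    next (≲-trans px py pz (proj₁ x≃y) (proj₁ y≃z) , ≲-trans pz py px (proj₂ y≃z) (proj₂ x≃y))
         (≤ₗ-trans pu pv pw u≤v v≤w)

  ≤ₗ-total : All P u → All P v → u ≤ₗ v ⊎ v ≤ₗ u
  ≤ₗ-total [] [] = inj₁ (base tt)
  ≤ₗ-total [] (_ ∷ _) = inj₁ halt
  ≤ₗ-total (_ ∷ _) [] = inj₂ halt
  ≤ₗ-total {x ∷ _} {y ∷ _} (px ∷ pu) (py ∷ pv) with T? (r y x) | T? (r x y)
  ... | no  y≴x | _        = inj₁ (this (≴⇒⋖ px py y≴x))
  ... | yes _   | no x≴y   = inj₂ (this (≴⇒⋖ py px x≴y))
  ... | yes y≲x | yes x≲y with ≤ₗ-total pu pv
  ...   | inj₁ u≤v = inj₁ (next (x≲y , y≲x) u≤v)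
  ...   | inj₂ v≤u = inj₂ (next (y≲x , x≲y) v≤u)

  ++-≤ₗ : ∀ v → All P u → u ≤ₗ u ++ v
  ++-≤ₗ v       []         = []-≤ₗ v
  ++-≤ₗ v       (px ∷ pxs) = next (≃-refl px) (++-≤ₗ v pxs)

  ++⁺-≤ₗ : All P w → u ≤ₗ v → w ++ u ≤ₗ w ++ v
  ++⁺-≤ₗ []         h = h
  ++⁺-≤ₗ (px ∷ pxs) h = next (≃-refl px) (++⁺-≤ₗ pxs h)

  Descending⇒tail-≤ₗ : All P (x ∷ xs) → Descending (x ∷ xs) → xs ≤ₗ x ∷ xs
  Descending⇒tail-≤ₗ {xs = []}    _              _           = halt
  Descending⇒tail-≤ₗ {xs = _ ∷ _} (_ ∷ ps) (y≲x ∷ ds) = ≲⇒∷-≤ₗ y≲x (Descending⇒tail-≤ₗ ps ds)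

  Descending⇒All-≲ : All P (x ∷ xs) → Descending (x ∷ xs) → All (_≲ x) xs
  Descending⇒All-≲ _              [-]        = []
  Descending⇒All-≲ (px ∷ py ∷ ps) (y≲x ∷ ds) =
    y≲x ∷ All.zipWith (λ (pz , z≲y) → ≲-trans pz py px z≲y y≲x) (ps , Descending⇒All-≲ (py ∷ ps) ds)

  non-leader : All P (x ∷ xs) → ¬ T (isLeader x xs) → ∃ λ z → z ∈ xs × x ⋖ z
  non-leader {x} {xs} (px ∷ pxs) not-leader =
    let z , z∈xs , z≴x = find (¬All⇒Any¬ (λ y → T? (r y x)) xs (not-leader ∘ all⁻ _))
    in z , z∈xs , ≴⇒⋖ px (All.lookup pxs z∈xs) z≴x

  leaders-head : ∀ x xs → All P (x ∷ xs) →
                 ∃₂ λ h t → leaders (x ∷ xs) ≡ h ∷ t × h ∈ x ∷ xs × All (_≲ h) (x ∷ xs)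
  leaders-head x xs pxs with isLeader x xs in leader
  ... | true = x , leaders xs , refl , here refl ,
               reflexive (All.head pxs) ∷ all⁺ _ xs (subst T (sym leader) tt)
  leaders-head x []       _          | false = ⊥-elim (subst T leader tt)
  leaders-head x (y ∷ ys) (px ∷ pys) | false =
    let h , t , eq , h∈ , ≲h = leaders-head y ys pys
        z , z∈ , x⋖z = non-leader (px ∷ pys) (subst T leader)
    in h , t , eq , there h∈ , ≲-trans px (All.lookup pys z∈) (All.lookup pys h∈) (proj₁ x⋖z) (All.lookup ≲h z∈) ∷ ≲h

  non-leader-⋖-leaders : All P (x ∷ xs) → ¬ T (isLeader x xs) → ∃₂ λ h t → leaders xs ≡ h ∷ t × x ⋖ h
  non-leader-⋖-leaders {xs = []} _ not-leader = ⊥-elim (not-leader tt)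
  non-leader-⋖-leaders {x} {y ∷ ys} (px ∷ pys) not-leader =
    let h , t , eq , h∈ , ≲h = leaders-head y ys pys
        z , z∈ , x⋖z = non-leader (px ∷ pys) not-leader
    in h , t , eq , ⋖-≲-trans px (All.lookup pys z∈) (All.lookup pys h∈) x⋖z (All.lookup ≲h z∈)

  leaders-maximal : ∀ xs → All P xs → S ⊆ xs → S ≤ₗ leaders xs
  leaders-maximal []       []         []  = base tt
  leaders-maximal (y ∷ ys) (py ∷ pys) S⊆ with isLeader y ys in leader
  leaders-maximal (y ∷ ys) (py ∷ pys) (y ∷ʳ S⊆)   | false = leaders-maximal ys pys S⊆
  leaders-maximal (y ∷ ys) (py ∷ pys) (refl ∷ S⊆) | false
    with non-leader-⋖-leaders (py ∷ pys) (subst T leader)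
  ... | h , t , eq , y⋖h rewrite eq = this y⋖h
  leaders-maximal (y ∷ ys) (py ∷ pys) (refl ∷ S⊆) | true = next (≃-refl py) (leaders-maximal ys pys S⊆)
  leaders-maximal {S = []}     (y ∷ ys) _ (y ∷ʳ S⊆) | true = []-≤ₗ _
  leaders-maximal {S = z ∷ S′} (y ∷ ys) (py ∷ pys) (y ∷ʳ S⊆) | true =
    ≲⇒∷-≤ₗ (All.lookup (all⁺ _ ys (subst T (sym leader) tt)) (Any-resp-⊆ S⊆ (here refl)))
           (leaders-maximal ys pys (∷ˡ⁻ S⊆))

  Descending⇒leaders≡ : All P xs → Descending xs → leaders xs ≡ xs
  Descending⇒leaders≡ {[]}     _   _  = refl
  Descending⇒leaders≡ {x ∷ xs} pxs ds with isLeader x xs in leader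
  ... | true  = cong (x ∷_) (Descending⇒leaders≡ (All.tail pxs) (Linked.tail ds))
  ... | false = ⊥-elim (subst T leader (all⁻ _ (Descending⇒All-≲ pxs ds)))

  leaders-idempotent : All P xs → leaders (leaders xs) ≡ leaders xs
  leaders-idempotent {xs} pxs =
    Descending⇒leaders≡ (All-resp-⊆ (leaders-⊆ xs) pxs) (leaders-descending xs)

  leaders∈maxSubseqs : All P xs → leaders xs ∈ maxSubseqs r xs
  leaders∈maxSubseqs {xs} pxs =
    ∈-filter⁺ (T? ∘ _) (∈-subseqs⁺ (leaders-⊆ xs))
      (all⁻ _ (All.tabulate (λ S∈ → ≤ₗ⇒lexLe (leaders-maximal xs pxs (∈-subseqs⁻ xs S∈)))))

  ∈-maxSubseqs⁻ : ∀ {C} → All P xs → C ∈ maxSubseqs r xs → C ⊆ xs × leaders xs ≤ₗ C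
  ∈-maxSubseqs⁻ {xs} {C} pxs C∈ =
    let C∈subseqs , C-max = ∈-filter⁻ (T? ∘ _) {xs = subseqs xs} C∈
    in ∈-subseqs⁻ xs C∈subseqs ,
       lexLe⇒≤ₗ _ _ (All.lookup (all⁺ _ _ C-max) (∈-subseqs⁺ (leaders-⊆ xs)))

  maxLexLe⇔leaders-≤ₗ : All P xs → All P ys → T (maxLexLe xs ys) ⇔ leaders xs ≤ₗ leaders ys
  maxLexLe⇔leaders-≤ₗ {xs} {ys} pxs pys = mk⇔ to from
    where
    to : T (maxLexLe xs ys) → leaders xs ≤ₗ leaders ys
    to h =
      let C , C∈ , h′ = find (any⁻ _ _ h)
          D , D∈ , C≤D = find (any⁻ _ _ h′)
          C⊆ , M≤C = ∈-maxSubseqs⁻ pxs C∈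
          D⊆ , _   = ∈-maxSubseqs⁻ pys D∈
          pM = All-resp-⊆ (leaders-⊆ xs) pxs
          pC = All-resp-⊆ C⊆ pxs
          pD = All-resp-⊆ D⊆ pys
      in ≤ₗ-trans pM pC (All-resp-⊆ (leaders-⊆ ys) pys) M≤C
           (≤ₗ-trans pC pD (All-resp-⊆ (leaders-⊆ ys) pys) (lexLe⇒≤ₗ _ _ C≤D) (leaders-maximal ys pys D⊆))
    from : leaders xs ≤ₗ leaders ys → T (maxLexLe xs ys)
    from h = any⁺ _ (lose (leaders∈maxSubseqs pxs) (any⁺ _ (lose (leaders∈maxSubseqs pys) (≤ₗ⇒lexLe h))))

  module Minimum {m : X} (m-min : ∀ {x} → P x → m ≲ x) where

    ∷ʳ-min-≤ₗ : All P u → All P v → u ≤ₗ v → ¬ v ≤ₗ u → u ++ [ m ] ≤ₗ v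
    ∷ʳ-min-≤ₗ _ _ (base _) v≰u = ⊥-elim (v≰u (base tt))
    ∷ʳ-min-≤ₗ _ (py ∷ _) halt _ = ≲⇒∷-≤ₗ (m-min py) ([]-≤ₗ _)
    ∷ʳ-min-≤ₗ _ _ (this x⋖y) _ = this x⋖y
    ∷ʳ-min-≤ₗ (_ ∷ pu) (_ ∷ pv) (next (x≲y , y≲x) u≤v) v≰u =
      next (x≲y , y≲x) (∷ʳ-min-≤ₗ pu pv u≤v (v≰u ∘ next (y≲x , x≲y)))

    isLeader-∷ʳ-min : P x → ∀ xs → isLeader x (xs ++ [ m ]) ≡ isLeader x xs
    isLeader-∷ʳ-min {x} px [] with r m x | m-min px
    ... | true | _ = refl
    isLeader-∷ʳ-min {x} px (y ∷ xs) = cong (r y x ∧_) (isLeader-∷ʳ-min px xs)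

    leaders-∷ʳ-min : All P xs → leaders (xs ++ [ m ]) ≡ leaders xs ++ [ m ]
    leaders-∷ʳ-min []                  = refl
    leaders-∷ʳ-min {x ∷ xs} (px ∷ pxs) rewrite isLeader-∷ʳ-min px xs with isLeader x xs
    ... | true  = cong (x ∷_) (leaders-∷ʳ-min pxs)
    ... | false = leaders-∷ʳ-min pxs

    Descending-∷ʳ-min : All P xs → Descending xs → Descending (xs ++ [ m ])
    Descending-∷ʳ-min []         []         = [-]
    Descending-∷ʳ-min (px ∷ [])  [-]        = m-min px ∷ [-]
    Descending-∷ʳ-min (_ ∷ pxs)  (y≲x ∷ ds) = y≲x ∷ Descending-∷ʳ-min pxs ds

  module ImmediateSuccessor {b s : X} (pb : P b) (ps : P s) (s-succ : ∀ {y} → P y → b ⋖ y → s ≲ y) where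

    private
      sublists-≤ₗ-∷ : ∀ c {a₀ a} → All (_⋖ a₀) c → s ≲ a₀ → S ⊆ c ++ [ s ] → S ≤ₗ a₀ ∷ a
      sublists-≤ₗ-∷ []      _          _    (_ ∷ʳ [])   = halt
      sublists-≤ₗ-∷ []      _          s≲a₀ (refl ∷ []) = ≲⇒∷-≤ₗ s≲a₀ ([]-≤ₗ _)
      sublists-≤ₗ-∷ (_ ∷ c) (_ ∷ c⋖)   s≲a₀ (_ ∷ʳ S⊆)   = sublists-≤ₗ-∷ c c⋖ s≲a₀ S⊆
      sublists-≤ₗ-∷ (_ ∷ c) (x⋖a₀ ∷ _) s≲a₀ (refl ∷ _)  = this x⋖a₀

    ⋖ₗ⇒successor-sublists-≤ₗ : ∀ c {a} → All P c → All P a → Descending (c ++ [ b ]) → Descending a →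
                               c ++ [ b ] ⋖ₗ a → S ⊆ c ++ [ s ] → S ≤ₗ a
    ⋖ₗ⇒successor-sublists-≤ₗ [] _ (pa₀ ∷ _) _ _ (here b⋖a₀) S⊆ =
      sublists-≤ₗ-∷ [] [] (s-succ pa₀ b⋖a₀) S⊆
    ⋖ₗ⇒successor-sublists-≤ₗ [] _ _ _ _ (there _ ())
    ⋖ₗ⇒successor-sublists-≤ₗ (x ∷ c) (px ∷ pc) (pa₀ ∷ _) dc _ (here x⋖a₀) S⊆ =
      sublists-≤ₗ-∷ (x ∷ c)
        (x⋖a₀ ∷ All.zipWith (λ (py , y≲x) → ≲-⋖-trans py px pa₀ y≲x x⋖a₀) (pc , ++⁻ˡ c ≲x))
        (s-succ pa₀ (≲-⋖-trans pb px pa₀ (All.head (++⁻ʳ c ≲x)) x⋖a₀)) S⊆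
      where ≲x = Descending⇒All-≲ (px ∷ ++⁺ pc (pb ∷ [])) dc
    ⋖ₗ⇒successor-sublists-≤ₗ (x ∷ c) (_ ∷ pc) (pa₀ ∷ pa) dc da (there _ c⋖a) (x ∷ʳ S⊆) =
      ≤ₗ-trans (All-resp-⊆ S⊆ (++⁺ pc (ps ∷ []))) pa (pa₀ ∷ pa)
        (⋖ₗ⇒successor-sublists-≤ₗ c pc pa (Linked.tail dc) (Linked.tail da) c⋖a S⊆)
        (Descending⇒tail-≤ₗ (pa₀ ∷ pa) da)
    ⋖ₗ⇒successor-sublists-≤ₗ (_ ∷ c) (_ ∷ pc) (_ ∷ pa) dc da (there x≃a₀ c⋖a) (refl ∷ S⊆) =
      next x≃a₀ (⋖ₗ⇒successor-sublists-≤ₗ c pc pa (Linked.tail dc) (Linked.tail da) c⋖a S⊆)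

maxLexLe-singleton : ∀ {X : Set} {r : X → X → Bool} {P : X → Set} → IsTotalPreorderOn r P →
                     ∀ {x y} → P x → P y → LexOrder.maxLexLe r [ x ] [ y ] ≡ r x y
maxLexLe-singleton tp px py =
  T-injective (mk⇔ (∷-≤ₗ⇒≲ ∘ Equivalence.to ⇔≤ₗ)
                   (Equivalence.from ⇔≤ₗ ∘ λ x≲y → ≲⇒∷-≤ₗ x≲y (base tt)))
  where
  open TotalLexOrder tp
  ⇔≤ₗ = maxLexLe⇔leaders-≤ₗ (px ∷ []) (py ∷ [])

-- Splitting a word at a letter

private variable
  n : ℕ

pieces-nonempty : ∀ n A → ∃₂ λ c cs → pieces n A ≡ c ∷ cs
pieces-nonempty n []       = [] , [] , refl
pieces-nonempty n (x ∷ xs) with pieces n xs | pieces-nonempty n xs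
... | c ∷ cs | _ with x ≡ᵇ n
...   | true  = [] , c ∷ cs , refl
...   | false = x ∷ c , cs , refl

pieces-∷-≢ : ∀ {x} xs {c cs} → x ≢ n → pieces n xs ≡ c ∷ cs → pieces n (x ∷ xs) ≡ (x ∷ c) ∷ cs
pieces-∷-≢ {n} {x} _ x≢n eq rewrite eq with x ≡ᵇ n in x≡ᵇn
... | false = refl
... | true  = ⊥-elim (x≢n (≡ᵇ⇒≡ x n (subst T (sym x≡ᵇn) tt)))

pieces-∷-≡ : ∀ n xs → pieces n (n ∷ xs) ≡ [] ∷ pieces n xs
pieces-∷-≡ n xs with c , cs , eq ← pieces-nonempty n xs rewrite eq with n ≡ᵇ n in n≡ᵇn
... | true  = refl
... | false = ⊥-elim (subst T n≡ᵇn (≡⇒≡ᵇ n n refl))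

intercalate-∷ : ∀ (s : Word) x c cs → intercalate s ((x ∷ c) ∷ cs) ≡ x ∷ intercalate s (c ∷ cs)
intercalate-∷ s x c []      = refl
intercalate-∷ s x c (_ ∷ _) = refl

intercalate-pieces : ∀ n A → intercalate [ n ] (pieces n A) ≡ A
intercalate-pieces n []       = refl
intercalate-pieces n (x ∷ xs)
  with c , cs , eq ← pieces-nonempty n xs | x ≟ n | intercalate-pieces n xs
... | yes refl | ih = begin
  intercalate [ x ] (pieces x (x ∷ xs)) ≡⟨ cong (intercalate [ x ]) (pieces-∷-≡ x xs) ⟩
  intercalate [ x ] ([] ∷ pieces x xs)  ≡⟨ cong (λ p → intercalate [ x ] ([] ∷ p)) eq ⟩
  x ∷ intercalate [ x ] (c ∷ cs)        ≡⟨ cong (x ∷_) (trans (cong (intercalate _) (sym eq)) ih) ⟩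
  x ∷ xs                                ∎
... | no x≢n | ih = begin
  intercalate [ n ] (pieces n (x ∷ xs)) ≡⟨ cong (intercalate [ n ]) (pieces-∷-≢ xs x≢n eq) ⟩
  intercalate [ n ] ((x ∷ c) ∷ cs)      ≡⟨ intercalate-∷ [ n ] x c cs ⟩
  x ∷ intercalate [ n ] (c ∷ cs)        ≡⟨ cong (x ∷_) (trans (cong (intercalate _) (sym eq)) ih) ⟩
  x ∷ xs                                ∎

pieces-++-free : ∀ {c} w {d ds} → All (_≢ n) c → pieces n w ≡ d ∷ ds → pieces n (c ++ w) ≡ (c ++ d) ∷ ds
pieces-++-free         w []            eq = eq
pieces-++-free {c = _ ∷ c} w (x≢n ∷ c≢n) eq = pieces-∷-≢ (c ++ w) x≢n (pieces-++-free w c≢n eq)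

pieces-free : ∀ {c} → All (_≢ n) c → pieces n c ≡ [ c ]
pieces-free {c = c} c≢n = subst (λ w → pieces _ w ≡ [ w ]) (++-identityʳ c) (pieces-++-free [] c≢n refl)

pieces-intercalate : ∀ {cs} → cs ≢ [] → All (All (_≢ n)) cs → pieces n (intercalate [ n ] cs) ≡ cs
pieces-intercalate {cs = []} cs≢[] _ = ⊥-elim (cs≢[] refl)
pieces-intercalate {cs = c ∷ []} _ (c≢n ∷ _) = pieces-free c≢n
pieces-intercalate {n} {cs = c ∷ d ∷ ds} _ (c≢n ∷ ds≢n) = begin
  pieces n (c ++ n ∷ intercalate [ n ] (d ∷ ds)) ≡⟨ pieces-++-free _ c≢n (trans (pieces-∷-≡ n rest) (cong ([] ∷_) ih)) ⟩
  (c ++ []) ∷ d ∷ ds                               ≡⟨ cong (_∷ d ∷ ds) (++-identityʳ c) ⟩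
  c ∷ d ∷ ds                                       ∎
  where
  rest = intercalate [ n ] (d ∷ ds)
  ih = pieces-intercalate {cs = d ∷ ds} (λ ()) ds≢n

pieces-All : ∀ {Q : ℕ → Set} n A → All Q A → All (All (λ x → Q x × x ≢ n)) (pieces n A)
pieces-All n []       []         = [] ∷ []
pieces-All n (x ∷ xs) (qx ∷ qxs) with c , cs , eq ← pieces-nonempty n xs | x ≟ n
... | yes refl rewrite pieces-∷-≡ x xs = [] ∷ pieces-All x xs qxs
... | no  x≢n  rewrite pieces-∷-≢ xs x≢n eq with subst (All _) eq (pieces-All n xs qxs)
...   | qc ∷ qcs = ((qx , x≢n) ∷ qc) ∷ qcs

intercalate-All : ∀ {Q : ℕ → Set} {cs} → Q n → All (All Q) cs → All Q (intercalate [ n ] cs)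
intercalate-All qn []                  = []
intercalate-All qn (qc ∷ [])           = qc
intercalate-All qn (qc ∷ qd ∷ qds)     = ++⁺ qc (qn ∷ intercalate-All qn (qd ∷ qds))

intercalate-∷ʳ-++ : ∀ (l : List Word) x w → intercalate [ n ] (l ++ [ x ]) ++ w ≡ intercalate [ n ] (l ++ [ x ++ w ])
intercalate-∷ʳ-++ []          x w = refl
intercalate-∷ʳ-++ (c ∷ [])    x w = ++-assoc c (_ ∷ x) w
intercalate-∷ʳ-++ {n} (c ∷ d ∷ l) x w = begin
  (c ++ n ∷ intercalate [ n ] (d ∷ l ++ [ x ])) ++ w ≡⟨ ++-assoc c _ w ⟩
  c ++ n ∷ intercalate [ n ] (d ∷ l ++ [ x ]) ++ w   ≡⟨ cong (λ z → c ++ n ∷ z) (intercalate-∷ʳ-++ (d ∷ l) x w) ⟩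
  c ++ n ∷ intercalate [ n ] (d ∷ l ++ [ x ++ w ])   ∎

pieces-++-free-∷ʳ : ∀ {A w l x} → All (_≢ n) w → pieces n A ≡ l ++ [ x ] → pieces n (A ++ w) ≡ l ++ [ x ++ w ]
pieces-++-free-∷ʳ {n} {A} {w} {l} {x} w≢n eq = begin
  pieces n (A ++ w)                                 ≡⟨ cong (λ B → pieces n (B ++ w)) A≡ ⟩
  pieces n (intercalate [ n ] (l ++ [ x ]) ++ w)   ≡⟨ cong (pieces n) (intercalate-∷ʳ-++ l x w) ⟩
  pieces n (intercalate [ n ] (l ++ [ x ++ w ]))   ≡⟨ pieces-intercalate (∷ʳ≢[] l) free′ ⟩
  l ++ [ x ++ w ]                                   ∎
  where
  A≡ : A ≡ intercalate [ n ] (l ++ [ x ])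
  A≡ = trans (sym (intercalate-pieces n A)) (cong (intercalate [ n ]) eq)
  free : All (All (_≢ n)) (l ++ [ x ])
  free = subst (All _) eq (All.map (All.map proj₂) (pieces-All {Q = λ _ → ⊤} n A (All.tabulate _)))
  free′ : All (All (_≢ n)) (l ++ [ x ++ w ])
  free′ = ++⁺ (++⁻ˡ l free) (++⁺ (All.head (++⁻ʳ l free)) w≢n ∷ [])

pieces-++-[n] : ∀ n A → pieces n (A ++ [ n ]) ≡ pieces n A ++ [ [] ]
pieces-++-[n] n []       = pieces-∷-≡ n []
pieces-++-[n] n (x ∷ xs) with c , cs , eq ← pieces-nonempty n xs | x ≟ n
... | yes refl = begin
  pieces x (x ∷ xs ++ [ x ])    ≡⟨ pieces-∷-≡ x (xs ++ [ x ]) ⟩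
  [] ∷ pieces x (xs ++ [ x ])   ≡⟨ cong ([] ∷_) (pieces-++-[n] x xs) ⟩
  [] ∷ pieces x xs ++ [ [] ]    ≡⟨ cong (_++ [ [] ]) (sym (pieces-∷-≡ x xs)) ⟩
  pieces x (x ∷ xs) ++ [ [] ]   ∎
... | no x≢n =
  trans (pieces-∷-≢ (xs ++ [ n ]) x≢n (trans (pieces-++-[n] n xs) (cong (_++ [ [] ]) eq)))
        (cong (_++ [ [] ]) (sym (pieces-∷-≢ xs x≢n eq)))

pieces-∷ʳ-view : ∀ n A → ∃₂ λ b′ bm → pieces n A ≡ b′ ++ [ bm ]
pieces-∷ʳ-view n A with pieces n A in eq
... | ps with initLast ps
...   | []        = case trans (sym eq) (proj₂ (proj₂ (pieces-nonempty n A))) of λ ()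
...   | b′ ∷ʳ′ bm = b′ , bm , refl

-- Letter ranges, and independence of ≾ and NF from the fuel

-- all letters lie in [lo, lo + f); then fuel f suffices for leF and nfF
InRange : ℕ → ℕ → Word → Set
InRange lo f = All (λ x → lo ≤ x × x < lo + f)

InRange-0⇒[] : ∀ {lo A} → InRange lo 0 A → A ≡ []
InRange-0⇒[] {lo} []                  = refl
InRange-0⇒[] {lo} {x ∷ _} ((lo≤x , x<lo) ∷ _) =
  ⊥-elim (<-irrefl refl (<-≤-trans (subst (x <_) (+-identityʳ lo) x<lo) lo≤x))

InRange-+ : ∀ {lo f} k {A} → InRange lo f A → InRange lo (k + f) A
InRange-+ {lo} {f} k = All.map λ (lo≤x , x<) → lo≤x , <-≤-trans x< (+-monoʳ-≤ lo (m≤n+m f k))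

InRange-raise : ∀ {lo f A} → All (suc lo ≤_) A → InRange lo (suc f) A → InRange (suc lo) f A
InRange-raise {lo} {f} lo<A A∈ =
  All.zipWith (λ {x} (lo<x , _ , x<) → lo<x , subst (x <_) (+-suc lo f) x<) (lo<A , A∈)

InRange-widen : ∀ {lo f A} → InRange (suc lo) f A → InRange lo (suc f) A
InRange-widen {lo} {f} = All.map λ {x} (lo<x , x<) → ≤-trans (n≤1+n lo) lo<x , subst (x <_) (sym (+-suc lo f)) x<

above⇒≢ : ∀ {lo C} → All (suc lo ≤_) C → All (_≢ lo) C
above⇒≢ = All.map λ lo<x x≡lo → <-irrefl (sym x≡lo) lo<x

minSym-lower : ∀ w ws → All (minSym (w ∷ ws) ≤_) (w ∷ ws)
minSym-lower w ws = let m≤w , m≤ws = go ws in m≤w ∷ m≤ws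
  where
  go : ∀ ws → foldr _⊓_ w ws ≤ w × All (foldr _⊓_ w ws ≤_) ws
  go []       = ≤-refl , []
  go (y ∷ ys) = let m≤w , m≤ys = go ys
                in ≤-trans (m⊓n≤n y _) m≤w , m⊓n≤m y _ ∷ All.map (≤-trans (m⊓n≤n y _)) m≤ys

minSym-greatest : ∀ {lo} w ws → All (lo ≤_) (w ∷ ws) → lo ≤ minSym (w ∷ ws)
minSym-greatest w ws (lo≤w ∷ lo≤ws) = go ws lo≤ws
  where
  go : ∀ ws → All (_ ≤_) ws → _ ≤ foldr _⊓_ w ws
  go []       []             = lo≤w
  go (y ∷ ys) (lo≤y ∷ lo≤ys) = ⊓-glb lo≤y (go ys lo≤ys)

lo-or-above : ∀ {lo f} C → InRange lo f C → (∃₂ λ w ws → C ≡ w ∷ ws × minSym (w ∷ ws) ≡ lo) ⊎ All (suc lo ≤_) C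
lo-or-above []       _  = inj₂ []
lo-or-above {lo} (w ∷ ws) C∈ with minSym (w ∷ ws) ≟ lo
... | yes least≡lo = inj₁ (w , ws , refl , least≡lo)
... | no  least≢lo = inj₂ (All.map (≤-trans lo<least) (minSym-lower w ws))
  where lo<least = ≤∧≢⇒< (minSym-greatest w ws (All.map proj₁ C∈)) (least≢lo ∘ sym)

InRange-maxSym : ∀ A → InRange 0 (suc (maxSym A)) A
InRange-maxSym []       = []
InRange-maxSym (x ∷ xs) =
  (z≤n , s≤s (m≤m⊔n x _)) ∷ All.map (λ { (_ , s≤s y≤m) → z≤n , s≤s (≤-trans y≤m (m≤n⊔m x _)) }) (InRange-maxSym xs)

pieces-InRange : ∀ {lo f n A} → lo ≤ n → All (n ≤_) A → InRange lo (suc f) A → All (InRange (suc lo) f) (pieces n A)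
pieces-InRange {lo} {f} {n} {A} lo≤n n≤A A∈ =
  All.map (All.map λ {x} ((n≤x , _ , x<) , x≢n) →
             ≤-<-trans lo≤n (≤∧≢⇒< n≤x (x≢n ∘ sym)) , subst (x <_) (+-suc lo f) x<)
          (pieces-All n A (All.zip (n≤A , A∈)))

pieces-InRange-lo : ∀ {lo f A} → InRange lo (suc f) A → All (InRange (suc lo) f) (pieces lo A)
pieces-InRange-lo A∈ = pieces-InRange ≤-refl (All.map proj₁ A∈) A∈

leF-unfold : ∀ f A B {w ws} → A ++ B ≡ w ∷ ws →
             leF (suc f) A B ≡ LexOrder.maxLexLe (leF f) (pieces (minSym (w ∷ ws)) A) (pieces (minSym (w ∷ ws)) B)
leF-unfold f A B eq with A ++ B | eq
... | _ | refl = refl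

leF-stable : ∀ f lo {A B} → InRange lo f A → InRange lo f B → leF f A B ≡ leF (suc f) A B
leF-stable zero    lo A∈ B∈ rewrite InRange-0⇒[] A∈ | InRange-0⇒[] B∈ = refl
leF-stable (suc f) lo {A} {B} A∈ B∈ with A ++ B in eq
... | []     = refl
... | w ∷ ws = maxLexLe-cong (leF-stable f (suc lo))
                 (pieces-InRange lo≤least (++⁻ˡ A least≤AB) A∈) (pieces-InRange lo≤least (++⁻ʳ A least≤AB) B∈)
  where
  least≤AB = subst (All _) (sym eq) (minSym-lower w ws)
  lo≤least = minSym-greatest w ws (subst (All _) eq (++⁺ (All.map proj₁ A∈) (All.map proj₁ B∈)))

leF-stable-+ : ∀ k f lo {A B} → InRange lo f A → InRange lo f B → leF f A B ≡ leF (k + f) A B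
leF-stable-+ zero    f lo _  _  = refl
leF-stable-+ (suc k) f lo A∈ B∈ = trans (leF-stable-+ k f lo A∈ B∈) (leF-stable (k + f) lo (InRange-+ k A∈) (InRange-+ k B∈))

leF-by-pieces : ∀ f lo → IsTotalPreorderOn (leF f) (InRange (suc lo) f) → ∀ {A B} →
            InRange lo (suc f) A → InRange lo (suc f) B →
            leF (suc f) A B ≡ LexOrder.maxLexLe (leF f) (pieces lo A) (pieces lo B)
leF-by-pieces f lo tp {A} {B} A∈ B∈ with lo-or-above (A ++ B) (++⁺ A∈ B∈)
... | inj₁ (w , ws , eq , refl) = leF-unfold f A B eq
... | inj₂ lo<AB = begin
  leF (suc f) A B                                      ≡⟨ sym (leF-stable f (suc lo) A∈′ B∈′) ⟩
  leF f A B                                            ≡⟨ sym (maxLexLe-singleton tp A∈′ B∈′) ⟩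
  LexOrder.maxLexLe (leF f) [ A ] [ B ]                ≡⟨ cong₂ (LexOrder.maxLexLe (leF f)) (sym (pieces-free (above⇒≢ lo<A)))
                                                                                               (sym (pieces-free (above⇒≢ lo<B))) ⟩
  LexOrder.maxLexLe (leF f) (pieces lo A) (pieces lo B) ∎
  where
  lo<A = ++⁻ˡ A lo<AB
  lo<B = ++⁻ʳ A lo<AB
  A∈′ = InRange-raise lo<A A∈
  B∈′ = InRange-raise lo<B B∈

leF-isTotalPreorderOn : ∀ f lo → IsTotalPreorderOn (leF f) (InRange lo f)
leF-isTotalPreorderOn zero    lo = record { reflexive = λ _ → tt ; transitive = λ _ _ _ _ _ → tt ; total = λ _ _ → inj₁ tt }
leF-isTotalPreorderOn (suc f) lo = record
  { reflexive  = λ A∈ → from A∈ A∈ (≤ₗ-refl (pl A∈))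
  ; transitive = λ A∈ B∈ C∈ A≤B B≤C →
      from A∈ C∈ (≤ₗ-trans (pl A∈) (pl B∈) (pl C∈) (to A∈ B∈ A≤B) (to B∈ C∈ B≤C))
  ; total      = λ A∈ B∈ → Sum.map (from A∈ B∈) (from B∈ A∈) (≤ₗ-total (pl A∈) (pl B∈))
  }
  where
  tp = leF-isTotalPreorderOn f (suc lo)
  open TotalLexOrder tp
  pl : ∀ {A} → InRange lo (suc f) A → All (InRange (suc lo) f) (leaders (pieces lo A))
  pl {A} A∈ = All-resp-⊆ (leaders-⊆ (pieces lo A)) (pieces-InRange-lo A∈)
  leF⇔ : ∀ {A B} → InRange lo (suc f) A → InRange lo (suc f) B →
         T (leF (suc f) A B) ⇔ leaders (pieces lo A) ≤ₗ leaders (pieces lo B)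
  leF⇔ {A} {B} A∈ B∈ =
    subst (λ b → T b ⇔ leaders (pieces lo A) ≤ₗ leaders (pieces lo B)) (sym (leF-by-pieces f lo tp A∈ B∈))
          (maxLexLe⇔leaders-≤ₗ (pieces-InRange-lo A∈) (pieces-InRange-lo B∈))
  to = λ {A} {B} A∈ B∈ → Equivalence.to (leF⇔ {A} {B} A∈ B∈)
  from = λ {A} {B} A∈ B∈ → Equivalence.from (leF⇔ {A} {B} A∈ B∈)

leB≡leF : ∀ lo f {A B} → InRange lo f A → InRange lo f B → leB A B ≡ leF f A B
leB≡leF lo f {A} {B} A∈ B∈ = begin
  leF (suc m) A B       ≡⟨ leF-stable-+ f (suc m) 0 (++⁻ˡ A AB∈) (++⁻ʳ A AB∈) ⟩
  leF (f + suc m) A B   ≡⟨ cong (λ k → leF k A B) (+-comm f (suc m)) ⟩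
  leF (suc m + f) A B   ≡⟨ sym (leF-stable-+ (suc m) f lo A∈ B∈) ⟩
  leF f A B             ∎
  where
  m = maxSym (A ++ B)
  AB∈ = InRange-maxSym (A ++ B)

leB-isTotalPreorderOn : ∀ lo f → IsTotalPreorderOn leB (InRange lo f)
leB-isTotalPreorderOn lo f = record
  { reflexive  = λ A∈ → from A∈ A∈ (reflexive A∈)
  ; transitive = λ A∈ B∈ C∈ A≤B B≤C → from A∈ C∈ (transitive A∈ B∈ C∈ (to A∈ B∈ A≤B) (to B∈ C∈ B≤C))
  ; total      = λ A∈ B∈ → Sum.map (from A∈ B∈) (from B∈ A∈) (total A∈ B∈)
  }
  where
  open IsTotalPreorderOn (leF-isTotalPreorderOn f lo)
  to : ∀ {A B} → InRange lo f A → InRange lo f B → T (leB A B) → T (leF f A B)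
  to A∈ B∈ = subst T (leB≡leF lo f A∈ B∈)
  from : ∀ {A B} → InRange lo f A → InRange lo f B → T (leF f A B) → T (leB A B)
  from A∈ B∈ = subst T (sym (leB≡leF lo f A∈ B∈))

leB-by-pieces : ∀ lo f {A B} → InRange lo (suc f) A → InRange lo (suc f) B →
            leB A B ≡ LexOrder.maxLexLe leB (pieces lo A) (pieces lo B)
leB-by-pieces lo f {A} {B} A∈ B∈ = begin
  leB A B                                               ≡⟨ leB≡leF lo (suc f) A∈ B∈ ⟩
  leF (suc f) A B                                       ≡⟨ leF-by-pieces f lo (leF-isTotalPreorderOn f (suc lo)) A∈ B∈ ⟩
  LexOrder.maxLexLe (leF f) (pieces lo A) (pieces lo B) ≡⟨ sym (maxLexLe-cong (leB≡leF (suc lo) f)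
                                                                 (pieces-InRange-lo A∈) (pieces-InRange-lo B∈)) ⟩
  LexOrder.maxLexLe leB (pieces lo A) (pieces lo B)     ∎

nfF-stable : ∀ f lo A → InRange lo f A → nfF f A ≡ nfF (suc f) A
nfF-stable zero    lo A        A∈ rewrite InRange-0⇒[] A∈ = refl
nfF-stable (suc f) lo []       _  = refl
nfF-stable (suc f) lo (x ∷ xs) A∈ =
  cong (descending (pieces least (x ∷ xs)) ∧_) (all-cong (nfF f) (nfF (suc f)) (pieces least (x ∷ xs)) λ C∈ →
    nfF-stable f (suc lo) _ (All.lookup (pieces-InRange (minSym-greatest x xs (All.map proj₁ A∈)) (minSym-lower x xs) A∈) C∈))
  where least = minSym (x ∷ xs)

nfF-stable-+ : ∀ k f lo A → InRange lo f A → nfF f A ≡ nfF (k + f) A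
nfF-stable-+ zero    f lo A _  = refl
nfF-stable-+ (suc k) f lo A A∈ = trans (nfF-stable-+ k f lo A A∈) (nfF-stable (k + f) lo A (InRange-+ k A∈))

isNF≡nfF : ∀ lo f {A} → InRange lo f A → isNF A ≡ nfF f A
isNF≡nfF lo f {A} A∈ = begin
  nfF (suc m) A       ≡⟨ nfF-stable-+ f (suc m) 0 A (InRange-maxSym A) ⟩
  nfF (f + suc m) A   ≡⟨ cong (λ k → nfF k A) (+-comm f (suc m)) ⟩
  nfF (suc m + f) A   ≡⟨ sym (nfF-stable-+ (suc m) f lo A A∈) ⟩
  nfF f A             ∎
  where m = maxSym A

isNF-by-pieces : ∀ lo f {A} → InRange lo (suc f) A → isNF A ≡ descending (pieces lo A) ∧ all isNF (pieces lo A)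
isNF-by-pieces lo f {A} A∈ with lo-or-above A A∈
... | inj₁ (w , ws , refl , refl) = trans (isNF≡nfF lo (suc f) A∈)
      (cong (descending (pieces lo A) ∧_) (all-cong (nfF f) isNF (pieces lo A) λ C∈ →
        sym (isNF≡nfF (suc lo) f (All.lookup (pieces-InRange-lo A∈) C∈))))
... | inj₂ lo<A rewrite pieces-free (above⇒≢ lo<A) = sym (∧-identityʳ (isNF A))

open LexOrder leB using () renaming (Descending to Descendingᴮ)

descending⇔Descending : ∀ l → T (descending l) ⇔ Descendingᴮ l
descending⇔Descending l = mk⇔ (to l) (from l)
  where
  to : ∀ l → T (descending l) → Descendingᴮ l
  to []          _ = []
  to (_ ∷ [])    _ = [-]
  to (x ∷ y ∷ l) h = let y≤x , d = Equivalence.to T-∧ h in y≤x ∷ to (y ∷ l) d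
  from : ∀ l → Descendingᴮ l → T (descending l)
  from []          _          = tt
  from (_ ∷ [])    _          = tt
  from (x ∷ y ∷ l) (y≤x ∷ d) = Equivalence.from T-∧ (y≤x , from (y ∷ l) d)

-- Comparison and normal forms through the pieces at the least letter

module ByPieces (lo f : ℕ) where

  open TotalLexOrder (leB-isTotalPreorderOn (suc lo) f) public

  private variable
    A B C : Word

  maxPieces : Word → List Word
  maxPieces A = leaders (pieces lo A)

  maxPieces-InRange : InRange lo (suc f) A → All (InRange (suc lo) f) (maxPieces A)
  maxPieces-InRange A∈ = All-resp-⊆ (leaders-⊆ _) (pieces-InRange-lo A∈)

  leB⇔ : InRange lo (suc f) A → InRange lo (suc f) B → T (leB A B) ⇔ maxPieces A ≤ₗ maxPieces B
  leB⇔ {A} {B} A∈ B∈ = subst (λ b → T b ⇔ maxPieces A ≤ₗ maxPieces B) (sym (leB-by-pieces lo f A∈ B∈))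
                         (maxLexLe⇔leaders-≤ₗ (pieces-InRange-lo A∈) (pieces-InRange-lo B∈))

  NF⇔ : InRange lo (suc f) A → NF A ⇔ (Descending (pieces lo A) × All NF (pieces lo A))
  NF⇔ {A} A∈ = subst (λ b → T b ⇔ (Descending (pieces lo A) × All NF (pieces lo A))) (sym (isNF-by-pieces lo f A∈))
    (mk⇔ (λ h → let d , a = Equivalence.to T-∧ h in Equivalence.to (descending⇔Descending _) d , all⁺ isNF _ a)
         (λ (d , a) → Equivalence.from T-∧ (Equivalence.from (descending⇔Descending _) d , all⁻ isNF a)))

  lo∈ : lo ≤ lo × lo < lo + suc f
  lo∈ = ≤-refl , subst (lo <_) (sym (+-suc lo f)) (s≤s (m≤m+n lo f))

  NF⇒maxPieces≡pieces : InRange lo (suc f) A → NF A → maxPieces A ≡ pieces lo A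
  NF⇒maxPieces≡pieces A∈ nf = Descending⇒leaders≡ (pieces-InRange-lo A∈) (proj₁ (Equivalence.to (NF⇔ A∈) nf))

  pieces-InRange-NF : InRange lo (suc f) A → NF A → All (λ C → InRange (suc lo) f C × NF C) (pieces lo A)
  pieces-InRange-NF A∈ nA = All.zip (pieces-InRange-lo A∈ , proj₂ (Equivalence.to (NF⇔ A∈) nA))

  NF-leB⇔ : InRange lo (suc f) A → InRange lo (suc f) B → NF A → NF B → T (leB A B) ⇔ pieces lo A ≤ₗ pieces lo B
  NF-leB⇔ {A} {B} A∈ B∈ nA nB =
    subst₂ (λ M N → T (leB A B) ⇔ M ≤ₗ N) (NF⇒maxPieces≡pieces A∈ nA) (NF⇒maxPieces≡pieces B∈ nB) (leB⇔ A∈ B∈)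

  -- if the pieces of C are normal, this is the normal form of C; so normalize (B ++ [ suc lo ]) is ◇_(suc lo) B
  normalize : Word → Word
  normalize C = intercalate [ lo ] (maxPieces C)

  pieces-normalize : InRange lo (suc f) C → pieces lo (normalize C) ≡ maxPieces C
  pieces-normalize {C} C∈ with c , cs , eq ← pieces-nonempty lo C
    with h , t , leaders≡ , _ ← leaders-head c cs (subst (All _) eq (pieces-InRange-lo C∈)) =
    pieces-intercalate (λ M≡[] → case trans (sym (trans (cong leaders eq) leaders≡)) M≡[] of λ ())
                       (All.map (above⇒≢ ∘ All.map proj₁) (maxPieces-InRange C∈))

  normalize-InRange : InRange lo (suc f) C → InRange lo (suc f) (normalize C)
  normalize-InRange {C} C∈ = intercalate-All lo∈ (All.map InRange-widen (maxPieces-InRange C∈))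

  normalize-NF : InRange lo (suc f) C → All NF (pieces lo C) → NF (normalize C)
  normalize-NF {C} C∈ nC = Equivalence.from (NF⇔ (normalize-InRange C∈))
    (subst (λ ps → Descending ps × All NF ps) (sym (pieces-normalize C∈))
      (leaders-descending (pieces lo C) , All-resp-⊆ (leaders-⊆ _) nC))

  normalize-∼ : InRange lo (suc f) C → normalize C ≃ C
  normalize-∼ {C} C∈ =
    Equivalence.from (leB⇔ N∈ C∈) (subst (_≤ₗ maxPieces C) (sym M≡) (≤ₗ-refl (maxPieces-InRange C∈))) ,
    Equivalence.from (leB⇔ C∈ N∈) (subst (maxPieces C ≤ₗ_) (sym M≡) (≤ₗ-refl (maxPieces-InRange C∈)))
    where
    N∈ = normalize-InRange C∈
    M≡ : maxPieces (normalize C) ≡ maxPieces C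
    M≡ = trans (cong leaders (pieces-normalize C∈)) (leaders-idempotent (pieces-InRange-lo C∈))

Λ-least : ∀ f lo {A} → InRange lo f A → T (leB [] A)
Λ-least zero    lo A∈ rewrite InRange-0⇒[] A∈ = tt
Λ-least (suc f) lo {A} A∈
  with c , cs , eq ← pieces-nonempty lo A
  with h , t , leaders≡ , h∈ , _ ← ByPieces.leaders-head lo f c cs (subst (All _) eq (pieces-InRange-lo A∈)) =
  Equivalence.from (leB⇔ [] A∈) (subst ([ [] ] ≤ₗ_) (sym (trans (cong leaders eq) leaders≡))
    (≲⇒∷-≤ₗ (Λ-least f (suc lo) (All.lookup (subst (All _) eq (pieces-InRange-lo A∈)) h∈)) ([]-≤ₗ t)))
  where open ByPieces lo f

NF-∼⇒≡ : ∀ f lo {A B} → InRange lo f A → InRange lo f B → NF A → NF B → T (leB A B) → T (leB B A) → A ≡ B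
NF-∼⇒≡ zero    lo A∈ B∈ _ _ _ _ = trans (InRange-0⇒[] A∈) (sym (InRange-0⇒[] B∈))
NF-∼⇒≡ (suc f) lo {A} {B} A∈ B∈ nA nB A≤B B≤A = begin
  A                                  ≡⟨ sym (intercalate-pieces lo A) ⟩
  intercalate [ lo ] (pieces lo A)   ≡⟨ cong (intercalate [ lo ]) pieces≡ ⟩
  intercalate [ lo ] (pieces lo B)   ≡⟨ intercalate-pieces lo B ⟩
  B                                  ∎
  where
  open ByPieces lo f
  open Antisymmetric {Q = λ C → InRange (suc lo) f C × NF C}
         (λ (C∈ , nC) (D∈ , nD) (C≤D , D≤C) → NF-∼⇒≡ f (suc lo) C∈ D∈ nC nD C≤D D≤C)
  pieces≡ = ≤ₗ-antisym (pieces-InRange-NF A∈ nA) (pieces-InRange-NF B∈ nB)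
              (Equivalence.to (NF-leB⇔ A∈ B∈ nA nB) A≤B) (Equivalence.to (NF-leB⇔ B∈ A∈ nB nA) B≤A)

≾[]⇒≡[] : ∀ f lo {B} → InRange lo f B → NF B → B ≾ [] → B ≡ []
≾[]⇒≡[] f lo B∈ nB B≲[] = NF-∼⇒≡ f lo B∈ [] nB tt B≲[] (Λ-least f lo B∈)

-- Successors and slices

module AppendLeast (lo f : ℕ) where

  open ByPieces lo f

  private variable
    b y : Word

  ∷ʳ-InRange : InRange lo (suc f) b → InRange lo (suc f) (b ++ [ lo ])
  ∷ʳ-InRange b∈ = ++⁺ b∈ (lo∈ ∷ [])

  private
    open Minimum {m = []} (Λ-least f (suc lo))

    maxPieces-∷ʳ : InRange lo (suc f) b → maxPieces (b ++ [ lo ]) ≡ maxPieces b ++ [ [] ]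
    maxPieces-∷ʳ {b} b∈ = trans (cong leaders (pieces-++-[n] lo b)) (leaders-∷ʳ-min (pieces-InRange-lo b∈))

  ∷ʳ-NF : InRange lo (suc f) b → NF b → NF (b ++ [ lo ])
  ∷ʳ-NF {b} b∈ nb = Equivalence.from (NF⇔ (∷ʳ-InRange b∈))
    (subst (λ ps → Descending ps × All NF ps) (sym (pieces-++-[n] lo b))
      (Descending-∷ʳ-min (pieces-InRange-lo b∈) (proj₁ (Equivalence.to (NF⇔ b∈) nb)) ,
       ++⁺ (proj₂ (Equivalence.to (NF⇔ b∈) nb)) (tt ∷ [])))

  ⋖-∷ʳ : InRange lo (suc f) b → b ⋖ b ++ [ lo ]
  ⋖-∷ʳ {b} b∈ =
    Equivalence.from (leB⇔ b∈ (∷ʳ-InRange b∈))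
      (subst (maxPieces b ≤ₗ_) (sym (maxPieces-∷ʳ b∈)) (++-≤ₗ _ (maxPieces-InRange b∈))) ,
    λ h → ++-≰ₗ (maxPieces b)
      (subst (_≤ₗ maxPieces b) (maxPieces-∷ʳ b∈) (Equivalence.to (leB⇔ (∷ʳ-InRange b∈) b∈) h))

  ∷ʳ-least-above : InRange lo (suc f) b → InRange lo (suc f) y → b ⋖ y → b ++ [ lo ] ≲ y
  ∷ʳ-least-above {b} {y} b∈ y∈ (b≲y , y≴b) =
    Equivalence.from (leB⇔ (∷ʳ-InRange b∈) y∈) (subst (_≤ₗ maxPieces y) (sym (maxPieces-∷ʳ b∈))
      (∷ʳ-min-≤ₗ (maxPieces-InRange b∈) (maxPieces-InRange y∈)
        (Equivalence.to (leB⇔ b∈ y∈) b≲y) (y≴b ∘ Equivalence.from (leB⇔ y∈ b∈))))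

module Slices (lo g : ℕ) where

  open ByPieces lo (suc g)
  open AppendLeast (suc lo) g using (⋖-∷ʳ; ∷ʳ-least-above; ∷ʳ-InRange; ∷ʳ-NF)

  private
    Piece = InRange (suc lo) (suc g)
    ≃⇒≡ : ∀ {C D} → Piece C × NF C → Piece D × NF D → C ≃ D → C ≡ D
    ≃⇒≡ (C∈ , nC) (D∈ , nD) (C≤D , D≤C) = NF-∼⇒≡ (suc g) (suc lo) C∈ D∈ nC nD C≤D D≤C

  open Antisymmetric ≃⇒≡

  ∷ʳsuc-InRange : ∀ {B} → InRange lo (suc (suc g)) B → InRange lo (suc (suc g)) (B ++ [ suc lo ])
  ∷ʳsuc-InRange B∈ = ++⁺ B∈ (InRange-widen (ByPieces.lo∈ (suc lo) g ∷ []))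

  private
    module _ {B : Word} (B∈ : InRange lo (suc (suc g)) B) (nB : NF B)
             {b′ : List Word} {bm : Word} (b≡ : pieces lo B ≡ b′ ++ [ bm ]) where

      private
        s = bm ++ [ suc lo ]
        b∈ = subst (All _) b≡ (pieces-InRange-NF B∈ nB)
        b′∈ = ++⁻ˡ b′ b∈
        bm∈ = All.head (++⁻ʳ b′ b∈)
        l∈ : All Piece (b′ ++ [ s ])
        l∈ = ++⁺ (All.map proj₁ b′∈) (∷ʳ-InRange (proj₁ bm∈) ∷ [])
        B⁺∈ = ∷ʳsuc-InRange B∈
        pieces-B⁺ : pieces lo (B ++ [ suc lo ]) ≡ b′ ++ [ s ]
        pieces-B⁺ = pieces-++-free-∷ʳ {A = B} (1+n≢n ∷ []) b≡
        maxPieces-B⁺ : maxPieces (B ++ [ suc lo ]) ≡ leaders (b′ ++ [ s ])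
        maxPieces-B⁺ = cong leaders pieces-B⁺
        PL′ : All Piece (leaders (b′ ++ [ s ]))
        PL′ = subst (All Piece) maxPieces-B⁺ (maxPieces-InRange B⁺∈)
        s≴bm : ¬ s ≲ bm
        s≴bm = proj₂ (⋖-∷ʳ (proj₁ bm∈))

      ∷ʳ-pieces-NF-view : All NF (pieces lo (B ++ [ suc lo ]))
      ∷ʳ-pieces-NF-view =
        subst (All NF) (sym pieces-B⁺) (++⁺ (All.map proj₂ b′∈) (∷ʳ-NF (proj₁ bm∈) (proj₂ bm∈) ∷ []))

      module _ {A : Word} (A∈ : InRange lo (suc (suc g)) A) (nA : NF A) where

        private
          a∈ = pieces-InRange-NF A∈ nA
          Pa = All.map proj₁ a∈
          a≡maxPieces = sym (NF⇒maxPieces≡pieces A∈ nA)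

        prefix⇒ : ∀ {rest} → pieces lo A ≡ pieces lo B ++ rest → B ≲ A × A ⋖ B ++ [ suc lo ]
        prefix⇒ {rest} a≡ = B≲A , A≲B⁺ , B⁺≴A
          where
          a≡′ : pieces lo A ≡ b′ ++ bm ∷ rest
          a≡′ = trans a≡ (trans (cong (_++ rest) b≡) (++-assoc b′ [ bm ] rest))
          B≲A = Equivalence.from (NF-leB⇔ B∈ A∈ nB nA)
                  (subst (pieces lo B ≤ₗ_) (sym a≡) (++-≤ₗ rest (All.map proj₁ (pieces-InRange-NF B∈ nB))))
          a≤l : pieces lo A ≤ₗ b′ ++ [ s ]
          a≤l = subst (_≤ₗ b′ ++ [ s ]) (sym a≡′) (++⁺-≤ₗ (All.map proj₁ b′∈) (this (⋖-∷ʳ (proj₁ bm∈))))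
          l≤L : b′ ++ [ s ] ≤ₗ leaders (b′ ++ [ s ])
          l≤L = leaders-maximal _ l∈ ⊆-refl
          A≲B⁺ = Equivalence.from (leB⇔ A∈ B⁺∈)
                   (subst₂ _≤ₗ_ a≡maxPieces (sym maxPieces-B⁺) (≤ₗ-trans Pa l∈ PL′ a≤l l≤L))
          B⁺≴A : ¬ B ++ [ suc lo ] ≲ A
          B⁺≴A h =
            s≴bm (∷-≤ₗ⇒≲ (++⁻-≤ₗ b′ (subst (b′ ++ [ s ] ≤ₗ_) a≡′ (≤ₗ-trans l∈ PL′ Pa l≤L L≤a))))
            where L≤a = subst₂ _≤ₗ_ maxPieces-B⁺ (sym a≡maxPieces) (Equivalence.to (leB⇔ B⁺∈ A∈) h)

        prefix⇐ : B ≲ A → A ⋖ B ++ [ suc lo ] → ∃ λ rest → pieces lo A ≡ pieces lo B ++ rest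
        prefix⇐ B≲A (_ , B⁺≴A) with ≤ₗ-split (Equivalence.to (NF-leB⇔ B∈ A∈ nB nA) B≲A)
        ... | inj₁ b⊑a = _ , Prefix⇒++-drop (pieces-InRange-NF B∈ nB) a∈ b⊑a
        ... | inj₂ b⋖a =
          ⊥-elim (B⁺≴A (Equivalence.from (leB⇔ B⁺∈ A∈) (subst₂ _≤ₗ_ (sym maxPieces-B⁺) a≡maxPieces L≤a)))
          where
          open ImmediateSuccessor (proj₁ bm∈) (∷ʳ-InRange (proj₁ bm∈)) (∷ʳ-least-above (proj₁ bm∈))
          pieces-descending : ∀ {C} → InRange lo (suc (suc g)) C → NF C → Descending (pieces lo C)
          pieces-descending C∈ nC = proj₁ (Equivalence.to (NF⇔ C∈) nC)
          L≤a : leaders (b′ ++ [ s ]) ≤ₗ pieces lo A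
          L≤a = ⋖ₗ⇒successor-sublists-≤ₗ b′ (All.map proj₁ b′∈) Pa (subst Descending b≡ (pieces-descending B∈ nB))
                  (pieces-descending A∈ nA) (subst (_⋖ₗ pieces lo A) b≡ b⋖a) (leaders-⊆ _)

  ∷ʳ-pieces-NF : ∀ {B} → InRange lo (suc (suc g)) B → NF B → All NF (pieces lo (B ++ [ suc lo ]))
  ∷ʳ-pieces-NF {B} B∈ nB with _ , _ , b≡ ← pieces-∷ʳ-view lo B = ∷ʳ-pieces-NF-view B∈ nB b≡

  prefix⇔ : ∀ {A B} → InRange lo (suc (suc g)) A → NF A → InRange lo (suc (suc g)) B → NF B →
            (∃ λ rest → pieces lo A ≡ pieces lo B ++ rest) ⇔ (B ≲ A × A ⋖ B ++ [ suc lo ])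
  prefix⇔ {A} {B} A∈ nA B∈ nB with _ , _ , b≡ ← pieces-∷ʳ-view lo B =
    mk⇔ (prefix⇒ B∈ nB b≡ A∈ nA ∘ proj₂) (λ (B≲A , A⋖B⁺) → prefix⇐ B∈ nB b≡ A∈ nA B≲A A⋖B⁺)

-- Definability

Sl⇔prefix : ∀ {A B} → Sl A B ⇔ (A ≢ [] × B ≢ [] × ∃ λ rest → pieces 0 A ≡ pieces 0 B ++ rest)
Sl⇔prefix {A} {B} = mk⇔ to from
  where
  to : Sl A B → A ≢ [] × B ≢ [] × ∃ λ rest → pieces 0 A ≡ pieces 0 B ++ rest
  to (A≢[] , _ , [] , _ , _ , _ , _ , refl , _) = ⊥-elim (A≢[] refl)
  to (A≢[] , B≢[] , Cs@(_ ∷ _) , Cs≥1 , suc m , _ , _ , refl , refl) = A≢[] , B≢[] , drop (suc m) Cs , (begin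
    pieces 0 (intercalate [ 0 ] Cs)                                   ≡⟨ pieces-intercalate (λ ()) Cs≢0 ⟩
    Cs                                                                ≡⟨ sym (take++drop≡id (suc m) Cs) ⟩
    take (suc m) Cs ++ drop (suc m) Cs                                ≡⟨ cong (_++ drop (suc m) Cs)
                                                                           (sym (pieces-intercalate (λ ()) (take⁺ (suc m) Cs≢0))) ⟩
    pieces 0 (intercalate [ 0 ] (take (suc m) Cs)) ++ drop (suc m) Cs ∎)
    where Cs≢0 = All.map (All.map λ { (s≤s _) () }) Cs≥1
  from : A ≢ [] × B ≢ [] × (∃ λ rest → pieces 0 A ≡ pieces 0 B ++ rest) → Sl A B
  from (A≢[] , B≢[] , rest , a≡) =
    A≢[] , B≢[] , pieces 0 A , Cs≥1 , length (pieces 0 B) , length≥1 , length≤ ,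
    sym (intercalate-pieces 0 A) , sym (trans (cong (intercalate [ 0 ]) take≡) (intercalate-pieces 0 B))
    where
    Cs≥1 = All.map (All.map (n≢0⇒n>0 ∘ proj₂)) (pieces-All {Q = λ _ → ⊤} 0 A (All.tabulate _))
    length≥1 : 1 ≤ length (pieces 0 B)
    length≥1 with _ , _ , eq ← pieces-nonempty 0 B rewrite eq = s≤s z≤n
    length≤ : length (pieces 0 B) ≤ length (pieces 0 A)
    length≤ = subst (length (pieces 0 B) ≤_) (sym (trans (cong length a≡) (length-++ (pieces 0 B))))
                    (m≤m+n (length (pieces 0 B)) (length rest))
    take≡ : take (length (pieces 0 B)) (pieces 0 A) ≡ pieces 0 B
    take≡ = trans (cong (take _) a≡) (take-length-++ (pieces 0 B) rest)

W3N⇔ : ∀ {A} → T (inW3 A ∧ isNF A) ⇔ (InRange 0 4 A × NF A)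
W3N⇔ {A} = mk⇔
  (λ h → let inW3 , nA = Equivalence.to T-∧ h
         in All.map (λ {x} x≤3 → z≤n , s≤s (≤ᵇ⇒≤ x 3 x≤3)) (all⁺ _ A inW3) , nA)
  (λ (A∈ , nA) → Equivalence.from T-∧ (all⁻ _ (All.map (λ { {x} (_ , s≤s x≤3) → ≤⇒≤ᵇ x≤3 }) A∈) , nA))

open TotalLexOrder (leB-isTotalPreorderOn 0 4) using (≲-trans; ≃-refl)
open ByPieces 0 3 using (normalize; normalize-InRange; normalize-NF; normalize-∼)
open Slices 0 2 using (∷ʳsuc-InRange; ∷ʳ-pieces-NF; prefix⇔)

module _ {A B : Word} (A∈ : InRange 0 4 A) (nA : NF A) (B∈ : InRange 0 4 B) (nB : NF B) where

  has-predecessor⇔nonempty : (Σ W3N λ C → word C ≺ B) ⇔ B ≢ []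
  has-predecessor⇔nonempty = mk⇔
    (λ ((C , wC) , _ , B≴C) B≡[] →
       B≴C (subst (λ B → T (leB B C)) (sym B≡[]) (Λ-least 4 0 (proj₁ (Equivalence.to (W3N⇔ {C}) wC)))))
    (λ B≢[] → ([] , tt) , Λ-least 4 0 B∈ , B≴[] B≢[])
    where
    B≴[] : B ≢ [] → ¬ B ≾ []
    B≴[] B≢[] B≲[] = B≢[] (≾[]⇒≡[] 4 0 B∈ nB B≲[])

  ≡⊎≺⇔≾ : (B ≡ A ⊎ B ≺ A) ⇔ B ≾ A
  ≡⊎≺⇔≾ = mk⇔ [ (λ { refl → proj₁ (≃-refl B∈) }) , proj₁ ]′ from
    where
    from : B ≾ A → B ≡ A ⊎ B ≺ A
    from B≲A with T? (leB A B)
    ... | yes A≲B = inj₁ (NF-∼⇒≡ 4 0 B∈ A∈ nB nA B≲A A≲B)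
    ... | no  A≴B = inj₂ (B≲A , A≴B)

  ≺◇₁⇔≺∷ʳ1 : (Σ W3N λ D → DiamondGraph 1 B (word D) × A ≺ word D) ⇔ A ≺ (B ++ [ 1 ])
  ≺◇₁⇔≺∷ʳ1 = mk⇔ to from
    where
    B⁺∈ = ∷ʳsuc-InRange B∈
    to : (Σ W3N λ D → DiamondGraph 1 B (word D) × A ≺ word D) → A ≺ (B ++ [ 1 ])
    to ((D , wD) , (_ , D≲B⁺ , B⁺≲D) , A≲D , D≴A) =
      ≲-trans A∈ D∈ B⁺∈ A≲D D≲B⁺ , λ B⁺≲A → D≴A (≲-trans D∈ B⁺∈ A∈ D≲B⁺ B⁺≲A)
      where D∈ = proj₁ (Equivalence.to (W3N⇔ {D}) wD)
    from : A ≺ (B ++ [ 1 ]) → Σ W3N λ D → DiamondGraph 1 B (word D) × A ≺ word D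
    from (A≲B⁺ , B⁺≴A) =
      (D , Equivalence.from W3N⇔ (D∈ , nD)) , (nD , D≃B⁺) ,
      ≲-trans A∈ B⁺∈ D∈ A≲B⁺ (proj₂ D≃B⁺) , λ D≲A → B⁺≴A (≲-trans B⁺∈ D∈ A∈ (proj₂ D≃B⁺) D≲A)
      where
      D = normalize (B ++ [ 1 ])
      D∈ = normalize-InRange B⁺∈
      nD = normalize-NF B⁺∈ (∷ʳ-pieces-NF B∈ nB)
      D≃B⁺ = normalize-∼ B⁺∈

  slice-condition⇔Sl : (B ≢ [] × B ≾ A × A ≺ (B ++ [ 1 ])) ⇔ Sl A B
  slice-condition⇔Sl =
    ⇔.trans (mk⇔ to λ (_ , B≢[] , p) → B≢[] , Equivalence.to (prefix⇔ A∈ nA B∈ nB) p) (⇔.sym Sl⇔prefix)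
    where
    to : B ≢ [] × B ≾ A × A ≺ (B ++ [ 1 ]) → A ≢ [] × B ≢ [] × (∃ λ rest → pieces 0 A ≡ pieces 0 B ++ rest)
    to (B≢[] , B≲A , A⋖B⁺) =
      (λ A≡[] → B≢[] (≾[]⇒≡[] 4 0 B∈ nB (subst (B ≾_) A≡[] B≲A))) , B≢[] ,
      Equivalence.from (prefix⇔ A∈ nA B∈ nB) (B≲A , A⋖B⁺)


slice-formula : Formula 2
slice-formula = ∃' (C ≺' B′) ∧' (((B ≐ A) ∨' (B ≺' A)) ∧' ∃' ((◇₁[ B′ ]≐ D) ∧' (A′ ≺' D)))
  where
  A B : Fin 2
  A = # 0
  B = # 1
  C D A′ B′ : Fin 3
  C  = # 0
  D  = # 0
  A′ = # 1
  B′ = # 2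

lemma6 : Σ (Formula 2) (λ φ → (A B : W3N) → Sat φ (A ∷ B ∷ []) ⇔ Sl (word A) (word B))
lemma6 = slice-formula , λ (A , wA) (B , wB) →
  let A∈ , nA = Equivalence.to (W3N⇔ {A}) wA
      B∈ , nB = Equivalence.to (W3N⇔ {B}) wB
  in ⇔.trans (has-predecessor⇔nonempty A∈ nA B∈ nB ×-⇔ ≡⊎≺⇔≾ A∈ nA B∈ nB ×-⇔ ≺◇₁⇔≺∷ʳ1 A∈ nA B∈ nB)
             (slice-condition⇔Sl A∈ nA B∈ nB)
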